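{- For $k\ge1$, $n\ge0$ and $0\le r\le n$, \[ M_{k,n,r}=\frac{1}{n+1}\binom{n+1}{r}\sum_{0\le j\le (n-r)/k}(-1)^j\binom{r}{j}\binom{n-jk-1}{r-1}. \] For $k\ge1$, $n\ge1$ and $0\le r\le n$, \[ C_{k+1,n,r}=\sum_{0\le j\le (n-r)/k}\frac{(-1)^j}{n}\binom{n}{r-1}\binom{r-1}{j}\binom{n-jk}{r}. \]
   Context: A plane tree is a rooted tree with linearly ordered children; the degree of a node is its number of children, and a node is internal if its degree is positive. $M_{k,n,r}$ is the number of plane trees with $n+1$ nodes, exactly $r$ of them internal, in which every node has degree at most $k$. $C_{k,n,r}$ is the number of plane trees with $n+1$ nodes, exactly $r$ of them internal (the root included), in which every non-root node has degree less than $k$. -}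

module Defs where

open import Data.Nat as ℕ using (ℕ; zero; suc; _∸_; _≤_; _<_; _≤?_)
open import Data.Nat.Combinatorics using (_C_)
open import Data.Integer as ℤ using (ℤ; +_; -[1+_])
open import Data.List using (List; []; _∷_; length)
open import Data.List.Relation.Unary.All using (All)
open import Data.Fin using (Fin)
open import Data.Product using (Σ; _×_)
open import Function.Bundles using (_↔_)
open import Relation.Nullary using (yes; no)
open import Relation.Binary.PropositionalEquality using (_≡_)

data PTree : Set where
  node : List PTree → PTree

deg : PTree → ℕ
deg (node ts) = length ts

mutual
  size : PTree → ℕ
  size (node ts) = suc (sizes ts)

  sizes : List PTree → ℕ
  sizes [] = 0
  sizes (t ∷ ts) = size t ℕ.+ sizes ts

mutual
  internal : PTree → ℕ
  internal (node []) = 0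
  internal (node (t ∷ ts)) = suc (internals (t ∷ ts))

  internals : List PTree → ℕ
  internals [] = 0
  internals (t ∷ ts) = internal t ℕ.+ internals ts

data MaxDeg (k : ℕ) : PTree → Set where
  node : ∀ {ts} → length ts ≤ k → All (MaxDeg k) ts → MaxDeg k (node ts)

data DegLt (k : ℕ) : PTree → Set where
  node : ∀ {ts} → length ts < k → All (DegLt k) ts → DegLt k (node ts)

NonRootDegLt : ℕ → PTree → Set
NonRootDegLt k (node ts) = All (DegLt k) ts

MSet : ℕ → ℕ → ℕ → Set
MSet k n r = Σ PTree (λ t → (size t ≡ suc n) × (internal t ≡ r) × MaxDeg k t)

CSet : ℕ → ℕ → ℕ → Set
CSet k n r = Σ PTree (λ t → (size t ≡ suc n) × (internal t ≡ r) × NonRootDegLt k t)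

HasCard : Set → ℕ → Set
HasCard A N = Fin N ↔ A

-- Negative upper index a = -1-a', nonnegative b: (-1)^b * C(a'+b, b).
-- Both negative (a = -1-a', b = -1-b'): (-1)^(b'-a') * C(b', b'-a') if b' ≥ a', else 0
-- (the symmetric extension; in particular binom(-1,-1) = 1).
sgn : ℕ → ℤ
sgn zero = + 1
sgn (suc m) = ℤ.- sgn m

binomZ : ℤ → ℤ → ℤ
binomZ (+ a) (+ b) = + (a C b)
binomZ (+ a) -[1+ b ] = + 0
binomZ -[1+ a ] (+ b) = sgn b ℤ.* + ((a ℕ.+ b) C b)
binomZ -[1+ a ] -[1+ b ] with a ≤? b
... | yes _ = sgn (b ∸ a) ℤ.* + (b C (b ∸ a))
... | no _ = + 0

-- Σ_{0 ≤ j ≤ m, j*k ≤ d} f j   (for k ≥ 1 and d ≤ m this is Σ_{0 ≤ j ≤ d/k} f j)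
sumUpTo : (m k d : ℕ) → (ℕ → ℤ) → ℤ
sumUpTo zero k d f with 0 ≤? d
... | yes _ = f 0
... | no _ = + 0
sumUpTo (suc m) k d f with suc m ℕ.* k ≤? d
... | yes _ = sumUpTo m k d f ℤ.+ f (suc m)
... | no _ = sumUpTo m k d f

-- A forest is determined by its first tree, which is either a leaf or a root of degree i + 1 ≤ k whose
-- children join the remaining trees. By induction on the number n of nodes this recursion yields the
-- cycle-lemma count n · F(m, n, r) = m · C(n, r) · c_r(n − m) for forests of m trees with r internal
-- nodes, where c_r(s) counts the compositions of s into r parts from {1, …, k}; the induction step uses
-- that each of the r parts contributes equally to their total s. Inclusion–exclusion over the parts
-- exceeding k gives c_r(s) = Σ_j (−1)^j C(r, j) C(s − jk − 1, r − 1), both sides satisfying the same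
-- difference equation in s. Then M_{k,n,r} = F(1, n + 1, r), while deleting the root turns the trees
-- counted by C_{k+1,n,r} into the forests counted by Σ_m F(m, n, r − 1), and Σ_m m · c_{r−1}(n − m)
-- is summed by the same difference-equation argument.
module Submission where

open import Defs
open import Data.Nat as ℕ using (ℕ; suc; _∸_; _≤_)
open import Data.Integer as ℤ using (ℤ; +_)
open import Data.Product using (Σ; _×_)
open import Relation.Binary.PropositionalEquality using (_≡_)
open import Data.Product using (_,_)

module Sum where

  open import Data.Nat using (zero)
  import Data.Nat.Properties as ℕ
  open import Data.Integer using (_+_; _*_; _-_)
  import Data.Integer.Properties as ℤ
  open import Data.Integer.Tactic.RingSolver using (solve-∀)
  open import Relation.Binary.PropositionalEquality
  open ≡-Reasoning

  +[1+m]-+[1+n]≡+m-+n : ∀ m n → + suc m - + suc n ≡ + m - + n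
  +[1+m]-+[1+n]≡+m-+n m n = cancel (+ m) (+ n)
    where
    cancel : ∀ a b → (+ 1 + a) - (+ 1 + b) ≡ a - b
    cancel = solve-∀

  ∑ : ℕ → (ℕ → ℤ) → ℤ
  ∑ zero f = + 0
  ∑ (suc N) f = ∑ N f + f N

  ∑-cong : ∀ N {f g : ℕ → ℤ} → (∀ i → f i ≡ g i) → ∑ N f ≡ ∑ N g
  ∑-cong zero eq = refl
  ∑-cong (suc N) eq = cong₂ _+_ (∑-cong N eq) (eq N)

  ∑-≡0 : ∀ N {f : ℕ → ℤ} → (∀ i → f i ≡ + 0) → ∑ N f ≡ + 0
  ∑-≡0 zero eq = refl
  ∑-≡0 (suc N) eq = cong₂ _+_ (∑-≡0 N eq) (eq N)

  ∑-distrib-+ : ∀ N (f g : ℕ → ℤ) → ∑ N (λ i → f i + g i) ≡ ∑ N f + ∑ N g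
  ∑-distrib-+ zero f g = refl
  ∑-distrib-+ (suc N) f g = begin
    ∑ N (λ i → f i + g i) + (f N + g N) ≡⟨ cong (_+ (f N + g N)) (∑-distrib-+ N f g) ⟩
    ∑ N f + ∑ N g + (f N + g N)         ≡⟨ +-interchange (∑ N f) _ _ _ ⟩
    ∑ N f + f N + (∑ N g + g N)         ∎
    where
    +-interchange : ∀ a b c d → a + b + (c + d) ≡ a + c + (b + d)
    +-interchange = solve-∀

  ∑-distrib-minus : ∀ N (f g : ℕ → ℤ) → ∑ N (λ i → f i - g i) ≡ ∑ N f - ∑ N g
  ∑-distrib-minus zero f g = refl
  ∑-distrib-minus (suc N) f g = begin
    ∑ N (λ i → f i - g i) + (f N - g N) ≡⟨ cong (_+ (f N - g N)) (∑-distrib-minus N f g) ⟩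
    ∑ N f - ∑ N g + (f N - g N)         ≡⟨ minus-interchange (∑ N f) _ _ _ ⟩
    ∑ N f + f N - (∑ N g + g N)         ∎
    where
    minus-interchange : ∀ a b c d → a - b + (c - d) ≡ a + c - (b + d)
    minus-interchange = solve-∀

  *-distribˡ-∑ : ∀ N (c : ℤ) (f : ℕ → ℤ) → c * ∑ N f ≡ ∑ N (λ i → c * f i)
  *-distribˡ-∑ zero c f = ℤ.*-zeroʳ c
  *-distribˡ-∑ (suc N) c f = begin
    c * (∑ N f + f N)             ≡⟨ ℤ.*-distribˡ-+ c (∑ N f) (f N) ⟩
    c * ∑ N f + c * f N           ≡⟨ cong (_+ c * f N) (*-distribˡ-∑ N c f) ⟩
    ∑ N (λ i → c * f i) + c * f N ∎

  ∑-sucˡ : ∀ N (f : ℕ → ℤ) → ∑ (suc N) f ≡ f 0 + ∑ N (λ i → f (suc i))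
  ∑-sucˡ zero f = ℤ.+-comm (+ 0) (f 0)
  ∑-sucˡ (suc N) f = begin
    ∑ (suc N) f + f (suc N)                  ≡⟨ cong (_+ f (suc N)) (∑-sucˡ N f) ⟩
    f 0 + ∑ N (λ i → f (suc i)) + f (suc N) ≡⟨ ℤ.+-assoc (f 0) _ _ ⟩
    f 0 + ∑ (suc N) (λ i → f (suc i))       ∎

  ∑-comm : ∀ N M (f : ℕ → ℕ → ℤ) → ∑ N (λ i → ∑ M (f i)) ≡ ∑ M (λ j → ∑ N (λ i → f i j))
  ∑-comm zero M f = sym (∑-≡0 M (λ _ → refl))
  ∑-comm (suc N) M f = begin
    ∑ N (λ i → ∑ M (f i)) + ∑ M (f N)         ≡⟨ cong (_+ ∑ M (f N)) (∑-comm N M f) ⟩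
    ∑ M (λ j → ∑ N (λ i → f i j)) + ∑ M (f N) ≡⟨ ∑-distrib-+ M _ (f N) ⟨
    ∑ M (λ j → ∑ (suc N) (λ i → f i j))       ∎

  ∑-vanishing-tail : ∀ N P (f : ℕ → ℤ) → N ≤ P → (∀ i → N ≤ i → f i ≡ + 0) → ∑ P f ≡ ∑ N f
  ∑-vanishing-tail N P f N≤P tail = begin
    ∑ P f               ≡⟨ cong (λ x → ∑ x f) (ℕ.m∸n+n≡m N≤P) ⟨
    ∑ (P ∸ N ℕ.+ N) f   ≡⟨ extend (P ∸ N) ⟩
    ∑ N f               ∎
    where
    extend : ∀ Q → ∑ (Q ℕ.+ N) f ≡ ∑ N f
    extend zero = refl
    extend (suc Q) = begin
      ∑ (Q ℕ.+ N) f + f (Q ℕ.+ N) ≡⟨ cong₂ _+_ (extend Q) (tail _ (ℕ.m≤n+m N Q)) ⟩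
      ∑ N f + + 0                 ≡⟨ ℤ.+-identityʳ _ ⟩
      ∑ N f                       ∎

  ∑-telescope : ∀ N (g : ℕ → ℤ) → ∑ N (λ i → g i - g (suc i)) ≡ g 0 - g N
  ∑-telescope zero g = sym (ℤ.+-inverseʳ (g 0))
  ∑-telescope (suc N) g = begin
    ∑ N (λ i → g i - g (suc i)) + (g N - g (suc N)) ≡⟨ cong (_+ (g N - g (suc N))) (∑-telescope N g) ⟩
    g 0 - g N + (g N - g (suc N))                   ≡⟨ cancel (g 0) _ _ ⟩
    g 0 - g (suc N)                                 ∎
    where
    cancel : ∀ a b c → a - b + (b - c) ≡ a - c
    cancel = solve-∀

  ∑ℕ : ℕ → (ℕ → ℕ) → ℕ
  ∑ℕ zero f = 0
  ∑ℕ (suc N) f = f 0 ℕ.+ ∑ℕ N (λ i → f (suc i))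

  pos-∑ℕ : ∀ N f → + ∑ℕ N f ≡ ∑ N (λ i → + f i)
  pos-∑ℕ zero f = refl
  pos-∑ℕ (suc N) f = begin
    + (f 0 ℕ.+ ∑ℕ N (λ i → f (suc i)))  ≡⟨ ℤ.pos-+ (f 0) _ ⟩
    + f 0 + + ∑ℕ N (λ i → f (suc i))    ≡⟨ cong (λ x → + f 0 + x) (pos-∑ℕ N (λ i → f (suc i))) ⟩
    + f 0 + ∑ N (λ i → + f (suc i))     ≡⟨ ∑-sucˡ N (λ i → + f i) ⟨
    ∑ (suc N) (λ i → + f i)             ∎

  ∑ℕ-zero : ∀ N → ∑ℕ N (λ _ → 0) ≡ 0
  ∑ℕ-zero zero = refl
  ∑ℕ-zero (suc N) = ∑ℕ-zero N

module Binomial where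

  open import Data.Nat using (zero; _+_; _*_; z≤n; s≤s)
  import Data.Nat.Properties as ℕ
  open import Data.Nat.Combinatorics
  open import Data.Nat.Tactic.RingSolver using (solve-∀)
  open import Relation.Binary.PropositionalEquality
  open ≡-Reasoning

  [1+r]*[1+n]C[1+r]≡[1+n]*nCr : ∀ n r → suc r * (suc n C suc r) ≡ suc n * (n C r)
  [1+r]*[1+n]C[1+r]≡[1+n]*nCr zero zero = refl
  [1+r]*[1+n]C[1+r]≡[1+n]*nCr zero (suc r) =
    trans (cong (suc (suc r) *_) (k>n⇒nCk≡0 (s≤s (s≤s (z≤n {r}))))) (ℕ.*-zeroʳ (suc (suc r)))
  [1+r]*[1+n]C[1+r]≡[1+n]*nCr (suc n) zero =
    trans (ℕ.+-identityʳ (suc (suc n) C 1)) (trans (nC1≡n (suc (suc n))) (sym (ℕ.*-identityʳ _)))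
  [1+r]*[1+n]C[1+r]≡[1+n]*nCr (suc n) (suc r) = begin
    suc (suc r) * (suc (suc n) C suc (suc r))
      ≡⟨ cong (suc (suc r) *_) (nCk+nC[k+1]≡[n+1]C[k+1] (suc n) (suc r)) ⟨
    suc (suc r) * (suc n C suc r + suc n C suc (suc r))
      ≡⟨ regroup (suc n C suc r) (suc n C suc (suc r)) r ⟩
    suc n C suc r + (suc r * (suc n C suc r) + suc (suc r) * (suc n C suc (suc r)))
      ≡⟨ cong₂ (λ a b → suc n C suc r + (a + b)) ([1+r]*[1+n]C[1+r]≡[1+n]*nCr n r)
                                                  ([1+r]*[1+n]C[1+r]≡[1+n]*nCr n (suc r)) ⟩
    suc n C suc r + (suc n * (n C r) + suc n * (n C suc r))
      ≡⟨ cong (λ x → suc n C suc r + x) (ℕ.*-distribˡ-+ (suc n) (n C r) _) ⟨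
    suc n C suc r + suc n * (n C r + n C suc r)
      ≡⟨ cong (λ x → suc n C suc r + suc n * x) (nCk+nC[k+1]≡[n+1]C[k+1] n r) ⟩
    suc (suc n) * (suc n C suc r) ∎
    where
    regroup : ∀ a b r → suc (suc r) * (a + b) ≡ a + (suc r * a + suc (suc r) * b)
    regroup = solve-∀

  [1+r]*nC[1+r]+r*nCr≡n*nCr : ∀ n r → suc r * (n C suc r) + r * (n C r) ≡ n * (n C r)
  [1+r]*nC[1+r]+r*nCr≡n*nCr zero zero = refl
  [1+r]*nC[1+r]+r*nCr≡n*nCr zero (suc r) =
    cong₂ _+_ (ℕ.*-zeroʳ (suc (suc r))) (ℕ.*-zeroʳ (suc r))
  [1+r]*nC[1+r]+r*nCr≡n*nCr (suc n) zero =
    trans (ℕ.+-identityʳ _) (trans (ℕ.+-identityʳ _) (trans (nC1≡n (suc n)) (sym (ℕ.*-identityʳ _))))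
  [1+r]*nC[1+r]+r*nCr≡n*nCr (suc n) (suc r) = begin
    suc (suc r) * (suc n C suc (suc r)) + suc r * (suc n C suc r)
      ≡⟨ cong₂ _+_ ([1+r]*[1+n]C[1+r]≡[1+n]*nCr n (suc r)) ([1+r]*[1+n]C[1+r]≡[1+n]*nCr n r) ⟩
    suc n * (n C suc r) + suc n * (n C r)
      ≡⟨ ℕ.*-distribˡ-+ (suc n) (n C suc r) (n C r) ⟨
    suc n * (n C suc r + n C r)
      ≡⟨ cong (suc n *_) (trans (ℕ.+-comm (n C suc r) (n C r)) (nCk+nC[k+1]≡[n+1]C[k+1] n r)) ⟩
    suc n * (suc n C suc r) ∎

module Compositions (k : ℕ) where

  open import Data.Nat using (zero)
  open import Data.Integer using (-[1+_]; _+_; _*_; _-_)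
  import Data.Integer.Properties as ℤ
  open import Data.Integer.Tactic.RingSolver using (solve-∀)
  open import Relation.Binary.PropositionalEquality
  open ≡-Reasoning
  open Sum

  δ : ℤ → ℤ
  δ (+ zero) = + 1
  δ _ = + 0

  *-δ≡0 : ∀ t → t * δ t ≡ + 0
  *-δ≡0 (+ zero) = refl
  *-δ≡0 (+ suc n) = ℤ.*-zeroʳ (+ suc n)
  *-δ≡0 -[1+ n ] = ℤ.*-zeroʳ -[1+ n ]

  compositions : ℕ → ℤ → ℤ
  compositions zero t = δ t
  compositions (suc r) t = ∑ k (λ i → compositions r (t - + suc i))

  compositions-neg : ∀ r a → compositions r -[1+ a ] ≡ + 0
  compositions-neg zero a = refl
  compositions-neg (suc r) a = ∑-≡0 k (λ i → compositions-neg r (suc (a ℕ.+ i)))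

  compositions-suc-0 : ∀ r → compositions (suc r) (+ 0) ≡ + 0
  compositions-suc-0 r = ∑-≡0 k (λ i → compositions-neg r i)

  firstPartTotal : ℕ → ℤ → ℤ
  firstPartTotal r s = ∑ k (λ i → + suc i * compositions r (s - + suc i))

  -- All r + 1 parts have the same total, so together they account for s times the number of compositions.
  *-compositions≡*-firstPartTotal : ∀ r s → s * compositions (suc r) s ≡ + suc r * firstPartTotal r s
  *-compositions≡*-firstPartTotal zero s = begin
    s * ∑ k (λ i → δ (s - + suc i))         ≡⟨ *-distribˡ-∑ k s _ ⟩
    ∑ k (λ i → s * δ (s - + suc i))         ≡⟨ ∑-cong k (λ i → onSupport (+ suc i)) ⟩
    ∑ k (λ i → + suc i * δ (s - + suc i))   ≡⟨ ℤ.*-identityˡ _ ⟨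
    + 1 * firstPartTotal zero s             ∎
    where
    split : ∀ s d x → s * x ≡ (s - d) * x + d * x
    split = solve-∀
    onSupport : ∀ d → s * δ (s - d) ≡ d * δ (s - d)
    onSupport d = begin
      s * δ (s - d)                     ≡⟨ split s d _ ⟩
      (s - d) * δ (s - d) + d * δ (s - d) ≡⟨ cong (_+ d * δ (s - d)) (*-δ≡0 (s - d)) ⟩
      + 0 + d * δ (s - d)               ≡⟨ ℤ.+-identityˡ _ ⟩
      d * δ (s - d)                     ∎
  *-compositions≡*-firstPartTotal (suc r) s = begin
    s * ∑ k (λ i → c (s - + suc i))
      ≡⟨ *-distribˡ-∑ k s _ ⟩
    ∑ k (λ i → s * c (s - + suc i))
      ≡⟨ ∑-cong k (λ i → split s (+ suc i) (c (s - + suc i))) ⟩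
    ∑ k (λ i → + suc i * c (s - + suc i) + (s - + suc i) * c (s - + suc i))
      ≡⟨ ∑-distrib-+ k _ _ ⟩
    A + ∑ k (λ i → (s - + suc i) * c (s - + suc i))
      ≡⟨ cong (λ x → A + x) (∑-cong k (λ i → *-compositions≡*-firstPartTotal r (s - + suc i))) ⟩
    A + ∑ k (λ i → + suc r * firstPartTotal r (s - + suc i))
      ≡⟨ cong (λ x → A + x) (*-distribˡ-∑ k (+ suc r) _) ⟨
    A + + suc r * ∑ k (λ i → firstPartTotal r (s - + suc i))
      ≡⟨ cong (λ x → A + + suc r * x) firstParts-of-tails ⟩
    A + + suc r * A
      ≡⟨ ℤ.suc-* (+ suc r) A ⟨
    + suc (suc r) * A ∎
    where
    c = compositions (suc r)
    A = firstPartTotal (suc r) s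
    split : ∀ s d x → s * x ≡ d * x + (s - d) * x
    split = solve-∀
    swap-minus : ∀ s a b → s - a - b ≡ s - b - a
    swap-minus = solve-∀
    firstParts-of-tails : ∑ k (λ i → firstPartTotal r (s - + suc i)) ≡ A
    firstParts-of-tails = begin
      ∑ k (λ i → ∑ k (λ j → + suc j * compositions r (s - + suc i - + suc j)))
        ≡⟨ ∑-comm k k _ ⟩
      ∑ k (λ j → ∑ k (λ i → + suc j * compositions r (s - + suc i - + suc j)))
        ≡⟨ ∑-cong k (λ j → ∑-cong k (λ i →
             cong (λ x → + suc j * compositions r x) (swap-minus s (+ suc i) (+ suc j)))) ⟩
      ∑ k (λ j → ∑ k (λ i → + suc j * compositions r (s - + suc j - + suc i)))
        ≡⟨ ∑-cong k (λ j → *-distribˡ-∑ k (+ suc j) _) ⟨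
      A ∎

module ForestCount (k : ℕ) where

  open import Data.Nat using (zero)
  open import Data.Nat.Combinatorics using (_C_)
  open import Data.Integer using (_+_; _*_; _-_)
  import Data.Integer.Properties as ℤ
  open import Data.Integer.Tactic.RingSolver using (solve-∀)
  open import Relation.Binary.PropositionalEquality
  open ≡-Reasoning
  open Sum
  open Binomial
  open Compositions k

  -- forests m n r counts forests of m plane trees with n nodes in total, r of them internal, and all
  -- degrees at most k: either the first tree is a leaf, or its root, of degree i + 1 ≤ k, is deleted.
  forests : ℕ → ℕ → ℕ → ℕ
  forests zero zero zero = 1
  forests zero zero (suc r) = 0
  forests (suc m) zero r = 0
  forests zero (suc n) r = 0
  forests (suc m) (suc n) zero = forests m n zero
  forests (suc m) (suc n) (suc r) = forests m n (suc r) ℕ.+ ∑ℕ k (λ i → forests (suc i ℕ.+ m) n r)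

  -- The ring-theoretic core of the induction step below, in which F₁ and S count the forests whose first
  -- tree is a leaf, respectively is not.
  forests-step-algebra : ∀ N M r X Y Z c A F₁ S →
    N * F₁ ≡ M * Y * c →
    N * S ≡ X * (A + M * c) →
    (+ 1 + r) * Y + r * X ≡ N * X →
    (N - M) * c ≡ (+ 1 + r) * A →
    (+ 1 + r) * Z ≡ (+ 1 + N) * X →
    (+ 1 + r) * (N * ((+ 1 + N) * (F₁ + S))) ≡ (+ 1 + r) * (N * ((+ 1 + M) * Z * c))
  forests-step-algebra N M r X Y Z c A F₁ S leaf root absorb symm absorb′ = begin
    (+ 1 + r) * (N * ((+ 1 + N) * (F₁ + S)))
      ≡⟨ expand N r F₁ S ⟩
    (+ 1 + r) * ((+ 1 + N) * (N * F₁ + N * S))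
      ≡⟨ cong₂ (λ u v → (+ 1 + r) * ((+ 1 + N) * (u + v))) leaf root ⟩
    (+ 1 + r) * ((+ 1 + N) * (M * Y * c + X * (A + M * c)))
      ≡⟨ regroup N M r X Y c A ⟩
    (+ 1 + N) * (M * c * ((+ 1 + r) * Y + r * X) + X * ((+ 1 + r) * A) + X * M * c)
      ≡⟨ cong₂ (λ u v → (+ 1 + N) * (M * c * u + X * v + X * M * c)) absorb (sym symm) ⟩
    (+ 1 + N) * (M * c * (N * X) + X * ((N - M) * c) + X * M * c)
      ≡⟨ collect N M X c ⟩
    N * ((+ 1 + M) * c) * ((+ 1 + N) * X)
      ≡⟨ cong (N * ((+ 1 + M) * c) *_) absorb′ ⟨
    N * ((+ 1 + M) * c) * ((+ 1 + r) * Z)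
      ≡⟨ reorder N M r Z c ⟩
    (+ 1 + r) * (N * ((+ 1 + M) * Z * c)) ∎
    where
    expand : ∀ N r F₁ S → (+ 1 + r) * (N * ((+ 1 + N) * (F₁ + S))) ≡ (+ 1 + r) * ((+ 1 + N) * (N * F₁ + N * S))
    expand = solve-∀
    regroup : ∀ N M r X Y c A → (+ 1 + r) * ((+ 1 + N) * (M * Y * c + X * (A + M * c))) ≡
      (+ 1 + N) * (M * c * ((+ 1 + r) * Y + r * X) + X * ((+ 1 + r) * A) + X * M * c)
    regroup = solve-∀
    collect : ∀ N M X c → (+ 1 + N) * (M * c * (N * X) + X * ((N - M) * c) + X * M * c) ≡
      N * ((+ 1 + M) * c) * ((+ 1 + N) * X)
    collect = solve-∀
    reorder : ∀ N M r Z c → N * ((+ 1 + M) * c) * ((+ 1 + r) * Z) ≡ (+ 1 + r) * (N * ((+ 1 + M) * Z * c))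
    reorder = solve-∀

  FormulaAt : ℕ → Set
  FormulaAt n = ∀ m r → + n * + forests m n r ≡ + m * + (n C r) * compositions r (+ n - + m)

  forests-formula-step : ∀ n → FormulaAt (suc n) → ∀ m r →
    + suc (suc n) * + forests (suc m) (suc (suc n)) (suc r) ≡
    + suc m * + (suc (suc n) C suc r) * compositions (suc r) (+ suc (suc n) - + suc m)
  forests-formula-step n ih m r =
    ℤ.*-cancelˡ-≡ N _ _ (ℤ.*-cancelˡ-≡ (+ suc r) _ _ (begin
      + suc r * (N * (+ suc (suc n) * + (F₁ ℕ.+ S)))
        ≡⟨ cong (λ x → + suc r * (N * (+ suc (suc n) * x))) (ℤ.pos-+ F₁ S) ⟩
      + suc r * (N * (+ suc (suc n) * (+ F₁ + + S)))
        ≡⟨ forests-step-algebra N (+ m) (+ r) X Y Z c (firstPartTotal r s) (+ F₁) (+ S)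
             (ih m (suc r)) first-root
             absorption₁ (*-compositions≡*-firstPartTotal r s) absorption₂ ⟩
      + suc r * (N * (+ suc m * Z * c))
        ≡⟨ cong (λ x → + suc r * (N * (+ suc m * Z * compositions (suc r) x))) (+[1+m]-+[1+n]≡+m-+n (suc n) m) ⟨
      + suc r * (N * (+ suc m * Z * compositions (suc r) (+ suc (suc n) - + suc m))) ∎))
    where
    N = + suc n
    s = N - + m
    c = compositions (suc r) s
    X = + (suc n C r)
    Y = + (suc n C suc r)
    Z = + (suc (suc n) C suc r)
    F₁ = forests m (suc n) (suc r)
    S = ∑ℕ k (λ i → forests (suc i ℕ.+ m) (suc n) r)
    absorption₁ : (+ 1 + + r) * Y + + r * X ≡ N * X
    absorption₁ = begin
      + suc r * Y + + r * X
        ≡⟨ cong₂ _+_ (ℤ.pos-* (suc r) (suc n C suc r)) (ℤ.pos-* r (suc n C r)) ⟨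
      + (suc r ℕ.* (suc n C suc r)) + + (r ℕ.* (suc n C r))
        ≡⟨ ℤ.pos-+ (suc r ℕ.* (suc n C suc r)) (r ℕ.* (suc n C r)) ⟨
      + (suc r ℕ.* (suc n C suc r) ℕ.+ r ℕ.* (suc n C r))
        ≡⟨ cong +_ ([1+r]*nC[1+r]+r*nCr≡n*nCr (suc n) r) ⟩
      + (suc n ℕ.* (suc n C r))
        ≡⟨ ℤ.pos-* (suc n) (suc n C r) ⟩
      N * X ∎
    absorption₂ : (+ 1 + + r) * Z ≡ (+ 1 + N) * X
    absorption₂ = begin
      + suc r * Z                          ≡⟨ ℤ.pos-* (suc r) (suc (suc n) C suc r) ⟨
      + (suc r ℕ.* (suc (suc n) C suc r))  ≡⟨ cong +_ ([1+r]*[1+n]C[1+r]≡[1+n]*nCr (suc n) r) ⟩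
      + (suc (suc n) ℕ.* (suc n C r))      ≡⟨ ℤ.pos-* (suc (suc n)) (suc n C r) ⟩
      + suc (suc n) * X                    ∎
    split : ∀ X d M x → (d + M) * X * x ≡ X * (d * x) + X * (M * x)
    split = solve-∀
    first-root : N * + S ≡ X * (firstPartTotal r s + + m * c)
    first-root = begin
      N * + S
        ≡⟨ cong (N *_) (pos-∑ℕ k _) ⟩
      N * ∑ k (λ i → + forests (suc i ℕ.+ m) (suc n) r)
        ≡⟨ *-distribˡ-∑ k N _ ⟩
      ∑ k (λ i → N * + forests (suc i ℕ.+ m) (suc n) r)
        ≡⟨ ∑-cong k (λ i → ih (suc i ℕ.+ m) r) ⟩
      ∑ k (λ i → + (suc i ℕ.+ m) * X * compositions r (N - + (suc i ℕ.+ m)))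
        ≡⟨ ∑-cong k (λ i → cong₂ (λ u v → u * X * compositions r v)
                                (ℤ.pos-+ (suc i) m) (minus-+ (+ suc i) (+ m))) ⟩
      ∑ k (λ i → (+ suc i + + m) * X * compositions r (s - + suc i))
        ≡⟨ ∑-cong k (λ i → split X (+ suc i) (+ m) (compositions r (s - + suc i))) ⟩
      ∑ k (λ i → X * (+ suc i * compositions r (s - + suc i)) + X * (+ m * compositions r (s - + suc i)))
        ≡⟨ ∑-distrib-+ k _ _ ⟩
      ∑ k (λ i → X * (+ suc i * compositions r (s - + suc i)))
        + ∑ k (λ i → X * (+ m * compositions r (s - + suc i)))
        ≡⟨ cong₂ _+_ (*-distribˡ-∑ k X _)
                     (trans (cong (X *_) (*-distribˡ-∑ k (+ m) _)) (*-distribˡ-∑ k X _)) ⟨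
      X * firstPartTotal r s + X * (+ m * c)
        ≡⟨ ℤ.*-distribˡ-+ X _ _ ⟨
      X * (firstPartTotal r s + + m * c) ∎
      where
      minus-+ : ∀ d M → N - (d + M) ≡ N - M - d
      minus-+ = solve-∀

  pos-forests-leaves : ∀ m n → + forests m n 0 ≡ δ (+ n - + m)
  pos-forests-leaves zero zero = refl
  pos-forests-leaves zero (suc n) = refl
  pos-forests-leaves (suc m) zero = refl
  pos-forests-leaves (suc m) (suc n) = trans (pos-forests-leaves m n) (cong δ (sym (+[1+m]-+[1+n]≡+m-+n n m)))

  forests-formula-leaves : ∀ n m → + n * + forests m n 0 ≡ + m * + 1 * δ (+ n - + m)
  forests-formula-leaves n m = begin
    + n * + forests m n 0                   ≡⟨ cong (+ n *_) (pos-forests-leaves m n) ⟩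
    + n * δ (+ n - + m)                     ≡⟨ split (+ n) (+ m) _ ⟩
    (+ n - + m) * δ (+ n - + m) + + m * + 1 * δ (+ n - + m)
      ≡⟨ cong (_+ + m * + 1 * δ (+ n - + m)) (*-δ≡0 (+ n - + m)) ⟩
    + 0 + + m * + 1 * δ (+ n - + m)         ≡⟨ ℤ.+-identityˡ _ ⟩
    + m * + 1 * δ (+ n - + m)               ∎
    where
    split : ∀ n m x → n * x ≡ (n - m) * x + m * + 1 * x
    split = solve-∀

  forests-formula : ∀ n → FormulaAt n
  forests-formula n m zero = forests-formula-leaves n m
  forests-formula zero zero (suc r) = refl
  forests-formula zero (suc m) (suc r) =
    sym (trans (cong (+ suc m * + (0 C suc r) *_) (compositions-neg (suc r) m)) (ℤ.*-zeroʳ (+ suc m * + (0 C suc r))))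
  forests-formula (suc n) zero (suc r) =
    trans (ℤ.*-zeroʳ (+ suc n)) (sym (ℤ.*-zeroˡ (compositions (suc r) (+ suc n - + 0))))
  forests-formula (suc zero) (suc m) (suc r) = begin
    + 1 * + forests (suc m) 1 (suc r)   ≡⟨ ℤ.*-identityˡ _ ⟩
    + forests (suc m) 1 (suc r)         ≡⟨ cong +_ (cong₂ ℕ._+_ (no-root-below m) (∑ℕ-zero k)) ⟩
    + 0                                 ≡⟨ ℤ.*-zeroʳ (+ suc m * + (1 C suc r)) ⟨
    + suc m * + (1 C suc r) * + 0       ≡⟨ cong (+ suc m * + (1 C suc r) *_) (no-composition m) ⟨
    + suc m * + (1 C suc r) * compositions (suc r) (+ 1 - + suc m) ∎
    where
    no-root-below : ∀ m → forests m 0 (suc r) ≡ 0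
    no-root-below zero = refl
    no-root-below (suc m) = refl
    no-composition : ∀ m → compositions (suc r) (+ 1 - + suc m) ≡ + 0
    no-composition zero = compositions-suc-0 r
    no-composition (suc m) = compositions-neg (suc r) m
  forests-formula (suc (suc n)) (suc m) (suc r) = forests-formula-step n (forests-formula (suc n)) m r

module Sieve (k : ℕ) where

  open import Data.Nat using (zero; _<_; s≤s)
  open import Data.Nat.Combinatorics using (_C_; k>n⇒nCk≡0; nCk+nC[k+1]≡[n+1]C[k+1])
  open import Data.Integer using (-[1+_]; _+_; _*_; _-_; -_)
  import Data.Integer.Properties as ℤ
  import Data.Nat.Properties as ℕ
  open import Data.Integer.Tactic.RingSolver using (solve-∀)
  open import Relation.Binary.PropositionalEquality
  open ≡-Reasoning
  open Sum
  open Compositions k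

  Δ : (ℤ → ℤ) → ℤ → ℤ
  Δ X t = X t - X (t - + 1)

  ≗-by-Δ : ∀ {X Y : ℤ → ℤ} → (∀ a → X -[1+ a ] ≡ Y -[1+ a ]) → (∀ n → Δ X (+ n) ≡ Δ Y (+ n)) →
           ∀ t → X t ≡ Y t
  ≗-by-Δ {X} {Y} neg ΔX≡ΔY = go
    where
    step : ∀ t → X (t - + 1) ≡ Y (t - + 1) → Δ X t ≡ Δ Y t → X t ≡ Y t
    step t prev Δt = begin
      X t                       ≡⟨ recover (X t) (X (t - + 1)) ⟩
      X (t - + 1) + Δ X t       ≡⟨ cong₂ _+_ prev Δt ⟩
      Y (t - + 1) + Δ Y t       ≡⟨ recover (Y t) (Y (t - + 1)) ⟨
      Y t                       ∎
      where
      recover : ∀ a b → a ≡ b + (a - b)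
      recover = solve-∀
    go : ∀ t → X t ≡ Y t
    go -[1+ a ] = neg a
    go (+ zero) = step (+ 0) (neg 0) (ΔX≡ΔY 0)
    go (+ suc n) = step (+ suc n) (go (+ n)) (ΔX≡ΔY (suc n))

  -- The operator (1 - Eᵏ)ʳ, where Eᵏ shifts the argument by k.
  sieve : ℕ → (ℤ → ℤ) → ℤ → ℤ
  sieve r X t = ∑ (suc r) (λ j → sgn j * + (r C j) * X (t - + (j ℕ.* k)))

  sgn*C*-beyond : ∀ r j x → r < j → sgn j * + (r C j) * x ≡ + 0
  sgn*C*-beyond r j x r<j = begin
    sgn j * + (r C j) * x   ≡⟨ cong (λ c → sgn j * + c * x) (k>n⇒nCk≡0 r<j) ⟩
    sgn j * + 0 * x         ≡⟨ cong (_* x) (ℤ.*-zeroʳ (sgn j)) ⟩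
    + 0 * x                 ≡⟨ ℤ.*-zeroˡ x ⟩
    + 0                     ∎

  sieve≡∑ : ∀ r X t n → r ≤ n → sieve r X t ≡ ∑ (suc n) (λ j → sgn j * + (r C j) * X (t - + (j ℕ.* k)))
  sieve≡∑ r X t n r≤n =
    sym (∑-vanishing-tail (suc r) (suc n) _ (s≤s r≤n) (λ j r<j → sgn*C*-beyond r j _ r<j))

  sieve-cong : ∀ r {X Y : ℤ → ℤ} → (∀ u → X u ≡ Y u) → ∀ t → sieve r X t ≡ sieve r Y t
  sieve-cong r eq t = ∑-cong (suc r) (λ j → cong (sgn j * + (r C j) *_) (eq _))

  private
    swap-minus : ∀ t a b → t - a - b ≡ t - b - a
    swap-minus = solve-∀

  sieve-shift : ∀ r X t → sieve r (λ u → X (u - + 1)) t ≡ sieve r X (t - + 1)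
  sieve-shift r X t =
    ∑-cong (suc r) (λ j → cong (λ u → sgn j * + (r C j) * X u) (swap-minus t (+ (j ℕ.* k)) (+ 1)))

  Δ-sieve : ∀ r X t → Δ (sieve r X) t ≡ sieve r (Δ X) t
  Δ-sieve r X t = begin
    sieve r X t - sieve r X (t - + 1)
      ≡⟨ ∑-distrib-minus (suc r) _ _ ⟨
    ∑ (suc r) (λ j → c j * X (t - + (j ℕ.* k)) - c j * X (t - + 1 - + (j ℕ.* k)))
      ≡⟨ ∑-cong (suc r) (λ j → cong (λ u → c j * X (t - + (j ℕ.* k)) - c j * X u)
                                    (swap-minus t (+ 1) (+ (j ℕ.* k)))) ⟩
    ∑ (suc r) (λ j → c j * X (t - + (j ℕ.* k)) - c j * X (t - + (j ℕ.* k) - + 1))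
      ≡⟨ ∑-cong (suc r) (λ j → factor (c j) _ _) ⟩
    sieve r (Δ X) t ∎
    where
    c : ℕ → ℤ
    c j = sgn j * + (r C j)
    factor : ∀ c a b → c * a - c * b ≡ c * (a - b)
    factor = solve-∀

  sieve-neg : ∀ r (X : ℤ → ℤ) → (∀ a → X -[1+ a ] ≡ + 0) → ∀ a → sieve r X -[1+ a ] ≡ + 0
  sieve-neg r X neg a = ∑-≡0 (suc r) (λ j → trans (cong (sgn j * + (r C j) *_) (further-neg (j ℕ.* k)))
                                                      (ℤ.*-zeroʳ (sgn j * + (r C j))))
    where
    further-neg : ∀ y → X (-[1+ a ] - + y) ≡ + 0
    further-neg zero = neg a
    further-neg (suc y) = neg (suc (a ℕ.+ y))

  -- Pascal's rule for the coefficients: (1 - Eᵏ)ʳ⁺¹ = (1 - Eᵏ)ʳ - Eᵏ (1 - Eᵏ)ʳ.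
  sieve-suc : ∀ r X t → sieve (suc r) X t ≡ sieve r X t - sieve r X (t - + k)
  sieve-suc r X t = begin
    sieve (suc r) X t
      ≡⟨ ∑-sucˡ (suc r) _ ⟩
    x 0 + ∑ (suc r) (λ j → - sgn j * + (suc r C suc j) * X (t - + (suc j ℕ.* k)))
      ≡⟨ cong (λ u → x 0 + u) (trans (∑-cong (suc r) pascal) (∑-distrib-minus (suc r) _ _)) ⟩
    x 0 + (∑ (suc r) (λ j → x (suc j)) - sieve r X (t - + k))
      ≡⟨ regroup (x 0) _ _ ⟩
    x 0 + ∑ (suc r) (λ j → x (suc j)) - sieve r X (t - + k)
      ≡⟨ cong (_- sieve r X (t - + k)) (∑-sucˡ (suc r) x) ⟨
    sieve r X t + x (suc r) - sieve r X (t - + k)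
      ≡⟨ cong (λ u → sieve r X t + u - sieve r X (t - + k)) (sgn*C*-beyond r (suc r) _ (ℕ.n<1+n r)) ⟩
    sieve r X t + + 0 - sieve r X (t - + k)
      ≡⟨ cong (_- sieve r X (t - + k)) (ℤ.+-identityʳ (sieve r X t)) ⟩
    sieve r X t - sieve r X (t - + k) ∎
    where
    x : ℕ → ℤ
    x j = sgn j * + (r C j) * X (t - + (j ℕ.* k))
    regroup : ∀ a b c → a + (b - c) ≡ (a + b) - c
    regroup = solve-∀
    split : ∀ s a b x → - s * (a + b) * x ≡ - s * b * x - s * a * x
    split = solve-∀
    minus-+ : ∀ t a b → t - (a + b) ≡ t - a - b
    minus-+ = solve-∀
    pascal : ∀ j → - sgn j * + (suc r C suc j) * X (t - + (suc j ℕ.* k)) ≡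
                   x (suc j) - sgn j * + (r C j) * X (t - + k - + (j ℕ.* k))
    pascal j = begin
      - sgn j * + (suc r C suc j) * X (t - + (suc j ℕ.* k))
        ≡⟨ cong (λ z → - sgn j * z * X (t - + (suc j ℕ.* k)))
                (trans (sym (cong +_ (nCk+nC[k+1]≡[n+1]C[k+1] r j))) (ℤ.pos-+ (r C j) (r C suc j))) ⟩
      - sgn j * (+ (r C j) + + (r C suc j)) * X (t - + (suc j ℕ.* k))
        ≡⟨ split (sgn j) _ _ _ ⟩
      x (suc j) - sgn j * + (r C j) * X (t - + (suc j ℕ.* k))
        ≡⟨ cong (λ u → x (suc j) - sgn j * + (r C j) * X u)
                (trans (cong (λ u → t - u) (ℤ.pos-+ k (j ℕ.* k))) (minus-+ t (+ k) (+ (j ℕ.* k)))) ⟩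
      x (suc j) - sgn j * + (r C j) * X (t - + k - + (j ℕ.* k)) ∎

  choose : ℕ → ℤ → ℤ
  choose s (+ a) = + (a C s)
  choose s -[1+ _ ] = + 0

  unboundedCompositions : ℕ → ℤ → ℤ
  unboundedCompositions zero t = δ t
  unboundedCompositions (suc r) t = choose r (t - + 1)

  unboundedCompositions-neg : ∀ r a → unboundedCompositions r -[1+ a ] ≡ + 0
  unboundedCompositions-neg zero a = refl
  unboundedCompositions-neg (suc r) a = refl

  Δ-choose : ∀ s u → Δ (choose s) u ≡ unboundedCompositions s u
  Δ-choose zero (+ zero) = refl
  Δ-choose zero (+ suc a) = refl
  Δ-choose zero -[1+ a ] = refl
  Δ-choose (suc s) (+ zero) = refl
  Δ-choose (suc s) -[1+ a ] = refl
  Δ-choose (suc s) (+ suc a) = begin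
    + (suc a C suc s) - + (a C suc s)            ≡⟨ cong (λ z → + z - + (a C suc s)) (nCk+nC[k+1]≡[n+1]C[k+1] a s) ⟨
    + (a C s ℕ.+ a C suc s) - + (a C suc s)      ≡⟨ cong (_- + (a C suc s)) (ℤ.pos-+ (a C s) (a C suc s)) ⟩
    + (a C s) + + (a C suc s) - + (a C suc s)    ≡⟨ cancel (+ (a C s)) (+ (a C suc s)) ⟩
    + (a C s)                                    ∎
    where
    cancel : ∀ a b → a + b - b ≡ a
    cancel = solve-∀

  Δ-compositions-suc : ∀ r t → Δ (compositions (suc r)) t ≡ compositions r (t - + 1) - compositions r (t - + 1 - + k)
  Δ-compositions-suc r t = begin
    compositions (suc r) t - compositions (suc r) (t - + 1)
      ≡⟨ ∑-distrib-minus k _ _ ⟨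
    ∑ k (λ i → compositions r (t - + suc i) - compositions r (t - + 1 - + suc i))
      ≡⟨ ∑-cong k (λ i → cong (λ z → compositions r z - g (suc i)) (minus-suc t (+ i))) ⟩
    ∑ k (λ i → g i - g (suc i))
      ≡⟨ ∑-telescope k g ⟩
    g 0 - g k
      ≡⟨ cong (λ z → compositions r z - g k) (ℤ.+-identityʳ (t - + 1)) ⟩
    compositions r (t - + 1) - compositions r (t - + 1 - + k) ∎
    where
    g : ℕ → ℤ
    g i = compositions r (t - + 1 - + i)
    minus-suc : ∀ t i → t - (+ 1 + i) ≡ t - + 1 - i
    minus-suc = solve-∀

  Δ-sieve-unboundedCompositions-suc : ∀ r t →
    Δ (sieve (suc r) (unboundedCompositions (suc r))) t ≡
    sieve r (unboundedCompositions r) (t - + 1) - sieve r (unboundedCompositions r) (t - + 1 - + k)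
  Δ-sieve-unboundedCompositions-suc r t = begin
    Δ (sieve (suc r) (unboundedCompositions (suc r))) t
      ≡⟨ Δ-sieve (suc r) (unboundedCompositions (suc r)) t ⟩
    sieve (suc r) (Δ (unboundedCompositions (suc r))) t
      ≡⟨ sieve-cong (suc r) (λ u → Δ-choose r (u - + 1)) t ⟩
    sieve (suc r) (λ u → unboundedCompositions r (u - + 1)) t
      ≡⟨ sieve-shift (suc r) (unboundedCompositions r) t ⟩
    sieve (suc r) (unboundedCompositions r) (t - + 1)
      ≡⟨ sieve-suc r (unboundedCompositions r) (t - + 1) ⟩
    sieve r (unboundedCompositions r) (t - + 1) - sieve r (unboundedCompositions r) (t - + 1 - + k) ∎

  compositions≡sieve : ∀ r t → compositions r t ≡ sieve r (unboundedCompositions r) t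
  compositions≡sieve zero t = begin
    δ t                   ≡⟨ cong δ (ℤ.+-identityʳ t) ⟨
    δ (t - + 0)           ≡⟨ unit (δ (t - + 0)) ⟩
    + 0 + + 1 * + 1 * δ (t - + 0) ∎
    where
    unit : ∀ x → x ≡ + 0 + + 1 * + 1 * x
    unit = solve-∀
  compositions≡sieve (suc r) = ≗-by-Δ
    (λ a → trans (compositions-neg (suc r) a)
                  (sym (sieve-neg (suc r) (unboundedCompositions (suc r)) (unboundedCompositions-neg (suc r)) a)))
    (λ n → begin
      Δ (compositions (suc r)) (+ n)
        ≡⟨ Δ-compositions-suc r (+ n) ⟩
      compositions r (+ n - + 1) - compositions r (+ n - + 1 - + k)
        ≡⟨ cong₂ _-_ (compositions≡sieve r _) (compositions≡sieve r _) ⟩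
      sieve r (unboundedCompositions r) (+ n - + 1) - sieve r (unboundedCompositions r) (+ n - + 1 - + k)
        ≡⟨ Δ-sieve-unboundedCompositions-suc r (+ n) ⟨
      Δ (sieve (suc r) (unboundedCompositions (suc r))) (+ n) ∎)

  Δ-sieve-choose : ∀ r t → Δ (sieve r (choose r)) t ≡ compositions r t
  Δ-sieve-choose r t = begin
    Δ (sieve r (choose r)) t                 ≡⟨ Δ-sieve r (choose r) t ⟩
    sieve r (Δ (choose r)) t                 ≡⟨ sieve-cong r (Δ-choose r) t ⟩
    sieve r (unboundedCompositions r) t      ≡⟨ compositions≡sieve r t ⟨
    compositions r t                         ∎

  Δ-sieve-choose-suc : ∀ r t → Δ (sieve r (choose (suc r))) t ≡ sieve r (choose r) (t - + 1)
  Δ-sieve-choose-suc r t = begin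
    Δ (sieve r (choose (suc r))) t                  ≡⟨ Δ-sieve r (choose (suc r)) t ⟩
    sieve r (Δ (choose (suc r))) t                  ≡⟨ sieve-cong r (Δ-choose (suc r)) t ⟩
    sieve r (λ u → choose r (u - + 1)) t            ≡⟨ sieve-shift r (choose r) t ⟩
    sieve r (choose r) (t - + 1)                    ∎

  Δ-+ : ∀ X n → Δ X (+ suc n) + X (+ n) ≡ X (+ suc n)
  Δ-+ X n = cancel (X (+ suc n)) (X (+ n))
    where
    cancel : ∀ a b → a - b + b ≡ a
    cancel = solve-∀

  ∑-compositions : ∀ r n → ∑ (suc n) (λ m → compositions r (+ n - + m)) ≡ sieve r (choose r) (+ n)
  ∑-compositions r zero = begin
    + 0 + compositions r (+ 0)                          ≡⟨ ℤ.+-identityˡ _ ⟩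
    compositions r (+ 0)                                ≡⟨ Δ-sieve-choose r (+ 0) ⟨
    sieve r (choose r) (+ 0) - sieve r (choose r) -[1+ 0 ]
      ≡⟨ cong (λ u → sieve r (choose r) (+ 0) - u) (sieve-neg r (choose r) (λ _ → refl) 0) ⟩
    sieve r (choose r) (+ 0) - + 0                      ≡⟨ ℤ.+-identityʳ _ ⟩
    sieve r (choose r) (+ 0)                            ∎
  ∑-compositions r (suc n) = begin
    ∑ (suc (suc n)) (λ m → compositions r (+ suc n - + m))
      ≡⟨ ∑-sucˡ (suc n) _ ⟩
    compositions r (+ suc n - + 0) + ∑ (suc n) (λ m → compositions r (+ suc n - + suc m))
      ≡⟨ cong₂ _+_ (cong (compositions r) (ℤ.+-identityʳ (+ suc n)))
                   (∑-cong (suc n) (λ m → cong (compositions r) (+[1+m]-+[1+n]≡+m-+n n m))) ⟩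
    compositions r (+ suc n) + ∑ (suc n) (λ m → compositions r (+ n - + m))
      ≡⟨ cong₂ _+_ (Δ-sieve-choose r (+ suc n)) (sym (∑-compositions r n)) ⟨
    Δ (sieve r (choose r)) (+ suc n) + sieve r (choose r) (+ n)
      ≡⟨ Δ-+ (sieve r (choose r)) n ⟩
    sieve r (choose r) (+ suc n) ∎

  ∑-*-compositions : ∀ r n → ∑ (suc n) (λ m → + m * compositions r (+ n - + m)) ≡ sieve r (choose (suc r)) (+ n)
  ∑-*-compositions r zero = begin
    + 0 + + 0 * compositions r (+ 0)                       ≡⟨ ℤ.*-zeroˡ (compositions r (+ 0)) ⟩
    + 0                                                   ≡⟨ ∑-≡0 (suc r) vanishes ⟨
    sieve r (choose (suc r)) (+ 0)                        ∎
    where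
    vanishes : ∀ j → sgn j * + (r C j) * choose (suc r) (+ 0 - + (j ℕ.* k)) ≡ + 0
    vanishes j with j ℕ.* k
    ... | zero = ℤ.*-zeroʳ (sgn j * + (r C j))
    ... | suc _ = ℤ.*-zeroʳ (sgn j * + (r C j))
  ∑-*-compositions r (suc n) = begin
    ∑ (suc (suc n)) (λ m → + m * compositions r (+ suc n - + m))
      ≡⟨ ∑-sucˡ (suc n) _ ⟩
    + 0 * compositions r (+ suc n - + 0) + ∑ (suc n) (λ m → + suc m * compositions r (+ suc n - + suc m))
      ≡⟨ cong₂ _+_ (ℤ.*-zeroˡ (compositions r (+ suc n - + 0)))
                   (∑-cong (suc n) (λ m → cong (λ z → + suc m * compositions r z) (+[1+m]-+[1+n]≡+m-+n n m))) ⟩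
    + 0 + ∑ (suc n) (λ m → + suc m * compositions r (+ n - + m))
      ≡⟨ ℤ.+-identityˡ _ ⟩
    ∑ (suc n) (λ m → + suc m * compositions r (+ n - + m))
      ≡⟨ ∑-cong (suc n) (λ m → ℤ.suc-* (+ m) (compositions r (+ n - + m))) ⟩
    ∑ (suc n) (λ m → compositions r (+ n - + m) + + m * compositions r (+ n - + m))
      ≡⟨ ∑-distrib-+ (suc n) _ _ ⟩
    ∑ (suc n) (λ m → compositions r (+ n - + m)) + ∑ (suc n) (λ m → + m * compositions r (+ n - + m))
      ≡⟨ cong₂ _+_ (∑-compositions r n) (∑-*-compositions r n) ⟩
    sieve r (choose r) (+ n) + sieve r (choose (suc r)) (+ n)
      ≡⟨ cong (_+ sieve r (choose (suc r)) (+ n)) (Δ-sieve-choose-suc r (+ suc n)) ⟨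
    Δ (sieve r (choose (suc r))) (+ suc n) + sieve r (choose (suc r)) (+ n)
      ≡⟨ Δ-+ (sieve r (choose (suc r))) n ⟩
    sieve r (choose (suc r)) (+ suc n) ∎

module Formulas (k : ℕ) where

  open import Data.Nat using (zero; _<_; z≤n; s≤s; _≤?_)
  import Data.Nat.Properties as ℕ
  open import Data.Nat.Combinatorics using (_C_; k>n⇒nCk≡0)
  open import Data.Integer using (-[1+_]; _+_; _*_; _-_)
  import Data.Integer.Properties as ℤ
  open import Data.Integer.Tactic.RingSolver using (solve-∀)
  open import Relation.Nullary using (yes; no; ¬_; contradiction)
  open import Relation.Binary.PropositionalEquality
  open ≡-Reasoning
  open Sum
  open Compositions k
  open Sieve k

  sumUpTo≡∑ : ∀ m d (f h : ℕ → ℤ) → (∀ j → j ℕ.* k ≤ d → f j ≡ h j) → (∀ j → ¬ j ℕ.* k ≤ d → h j ≡ + 0) →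
              sumUpTo m k d f ≡ ∑ (suc m) h
  sumUpTo≡∑ zero d f h inside outside with 0 ≤? d
  ... | yes 0≤d = trans (inside 0 0≤d) (sym (ℤ.+-identityˡ (h 0)))
  ... | no 0≰d = contradiction z≤n 0≰d
  sumUpTo≡∑ (suc m) d f h inside outside with suc m ℕ.* k ≤? d
  ... | yes ≤d = cong₂ _+_ (sumUpTo≡∑ m d f h inside outside) (inside (suc m) ≤d)
  ... | no ≰d = begin
    sumUpTo m k d f           ≡⟨ sumUpTo≡∑ m d f h inside outside ⟩
    ∑ (suc m) h               ≡⟨ ℤ.+-identityʳ _ ⟨
    ∑ (suc m) h + + 0         ≡⟨ cong (λ x → ∑ (suc m) h + x) (outside (suc m) ≰d) ⟨
    ∑ (suc (suc m)) h         ∎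

  vanishes-below : ∀ r (X : ℤ → ℤ) → (∀ a → X -[1+ a ] ≡ + 0) → (∀ a → a < r → X (+ a) ≡ + 0) →
                   ∀ n y → n < y ℕ.+ r → X (+ n - + y) ≡ + 0
  vanishes-below r X neg small n zero n<r = trans (cong X (ℤ.+-identityʳ (+ n))) (small n n<r)
  vanishes-below r X neg small zero (suc y) _ = neg y
  vanishes-below r X neg small (suc n) (suc y) (s≤s n<y+r) =
    trans (cong X (+[1+m]-+[1+n]≡+m-+n n y)) (vanishes-below r X neg small n y n<y+r)

  choose-small : ∀ s a → a < s → choose s (+ a) ≡ + 0
  choose-small s a a<s = cong +_ (k>n⇒nCk≡0 a<s)

  unboundedCompositions-small : ∀ r a → a < r → unboundedCompositions r (+ a) ≡ + 0
  unboundedCompositions-small (suc r) zero _ = refl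
  unboundedCompositions-small (suc r) (suc a) (s≤s a<r) = choose-small r a a<r

  binomZ-unboundedCompositions : ∀ r a → r ≤ a → binomZ (+ a - + 1) (+ r - + 1) ≡ unboundedCompositions r (+ a)
  binomZ-unboundedCompositions zero zero _ = refl
  binomZ-unboundedCompositions zero (suc a) _ = refl
  binomZ-unboundedCompositions (suc r) (suc a) _ = refl

  private
    r≤n∸y : ∀ {y n r} → r ≤ n → y ≤ n ∸ r → r ≤ n ∸ y
    r≤n∸y {y} {n} {r} r≤n y≤n∸r =
      ℕ.m+n≤o⇒m≤o∸n r (subst (_≤ n) (ℕ.+-comm y r) (ℕ.m≤o∸n⇒m+n≤o y r≤n y≤n∸r))

    n<y+r : ∀ {y n r} → r ≤ n → ¬ y ≤ n ∸ r → n < y ℕ.+ r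
    n<y+r {y} {n} {r} r≤n y≰n∸r = subst (_< y ℕ.+ r) (ℕ.m∸n+n≡m r≤n) (ℕ.+-monoˡ-< r (ℕ.≰⇒> y≰n∸r))

    +n-+y≡+[n∸y] : ∀ {y} n r → y ≤ n ∸ r → + n - + y ≡ + (n ∸ y)
    +n-+y≡+[n∸y] {y} n r y≤n∸r = trans (ℤ.m-n≡m⊖n n y) (ℤ.⊖-≥ (ℕ.≤-trans y≤n∸r (ℕ.m∸n≤m n r)))

  sumUpTo≡compositions-sieve : ∀ n r → r ≤ n →
    sumUpTo n k (n ∸ r) (λ j → sgn j * binomZ (+ r) (+ j) * binomZ (+ n - + (j ℕ.* k) - + 1) (+ r - + 1)) ≡
    sieve r (unboundedCompositions r) (+ n)
  sumUpTo≡compositions-sieve n r r≤n = begin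
    sumUpTo n k (n ∸ r) _ ≡⟨ sumUpTo≡∑ n (n ∸ r) _ _ inside outside ⟩
    ∑ (suc n) term        ≡⟨ sieve≡∑ r (unboundedCompositions r) (+ n) n r≤n ⟨
    sieve r (unboundedCompositions r) (+ n) ∎
    where
    term : ℕ → ℤ
    term j = sgn j * + (r C j) * unboundedCompositions r (+ n - + (j ℕ.* k))
    inside : ∀ j → j ℕ.* k ≤ n ∸ r →
             sgn j * + (r C j) * binomZ (+ n - + (j ℕ.* k) - + 1) (+ r - + 1) ≡ term j
    inside j p = cong (sgn j * + (r C j) *_) (begin
      binomZ (+ n - + (j ℕ.* k) - + 1) (+ r - + 1)
        ≡⟨ cong (λ t → binomZ (t - + 1) (+ r - + 1)) (+n-+y≡+[n∸y] n r p) ⟩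
      binomZ (+ (n ∸ j ℕ.* k) - + 1) (+ r - + 1)
        ≡⟨ binomZ-unboundedCompositions r (n ∸ j ℕ.* k) (r≤n∸y r≤n p) ⟩
      unboundedCompositions r (+ (n ∸ j ℕ.* k))
        ≡⟨ cong (unboundedCompositions r) (+n-+y≡+[n∸y] n r p) ⟨
      unboundedCompositions r (+ n - + (j ℕ.* k)) ∎)
    outside : ∀ j → ¬ j ℕ.* k ≤ n ∸ r → term j ≡ + 0
    outside j p = trans (cong (sgn j * + (r C j) *_) (vanishes-below r (unboundedCompositions r)
                          (unboundedCompositions-neg r) (unboundedCompositions-small r) n _ (n<y+r r≤n p)))
                        (ℤ.*-zeroʳ (sgn j * + (r C j)))

  sumUpTo≡choose-sieve : ∀ n r → suc r ≤ n →
    sumUpTo n k (n ∸ suc r) (λ j → sgn j * binomZ (+ n) (+ suc r - + 1) * binomZ (+ suc r - + 1) (+ j)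
                                     * binomZ (+ n - + (j ℕ.* k)) (+ suc r)) ≡
    + (n C r) * sieve r (choose (suc r)) (+ n)
  sumUpTo≡choose-sieve n r r<n = begin
    sumUpTo n k (n ∸ suc r) _  ≡⟨ sumUpTo≡∑ n (n ∸ suc r) _ _ inside outside ⟩
    ∑ (suc n) (λ j → + (n C r) * term j)
      ≡⟨ *-distribˡ-∑ (suc n) (+ (n C r)) term ⟨
    + (n C r) * ∑ (suc n) term ≡⟨ cong (+ (n C r) *_) (sieve≡∑ r (choose (suc r)) (+ n) n (ℕ.<⇒≤ r<n)) ⟨
    + (n C r) * sieve r (choose (suc r)) (+ n) ∎
    where
    term : ℕ → ℤ
    term j = sgn j * + (r C j) * choose (suc r) (+ n - + (j ℕ.* k))
    regroup : ∀ s x c b → s * x * c * b ≡ x * (s * c * b)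
    regroup = solve-∀
    inside : ∀ j → j ℕ.* k ≤ n ∸ suc r →
             sgn j * + (n C r) * + (r C j) * binomZ (+ n - + (j ℕ.* k)) (+ suc r) ≡ + (n C r) * term j
    inside j p = begin
      sgn j * + (n C r) * + (r C j) * binomZ (+ n - + (j ℕ.* k)) (+ suc r)
        ≡⟨ cong (λ t → sgn j * + (n C r) * + (r C j) * binomZ t (+ suc r)) (+n-+y≡+[n∸y] n (suc r) p) ⟩
      sgn j * + (n C r) * + (r C j) * choose (suc r) (+ (n ∸ j ℕ.* k))
        ≡⟨ cong (λ t → sgn j * + (n C r) * + (r C j) * choose (suc r) t) (+n-+y≡+[n∸y] n (suc r) p) ⟨
      sgn j * + (n C r) * + (r C j) * choose (suc r) (+ n - + (j ℕ.* k))
        ≡⟨ regroup (sgn j) (+ (n C r)) (+ (r C j)) _ ⟩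
      + (n C r) * term j ∎
    outside : ∀ j → ¬ j ℕ.* k ≤ n ∸ suc r → + (n C r) * term j ≡ + 0
    outside j p = begin
      + (n C r) * term j
        ≡⟨ cong (λ x → + (n C r) * (sgn j * + (r C j) * x))
                (vanishes-below (suc r) (choose (suc r)) (λ _ → refl) (choose-small (suc r)) n _ (n<y+r r<n p)) ⟩
      + (n C r) * (sgn j * + (r C j) * + 0)
        ≡⟨ cong (+ (n C r) *_) (ℤ.*-zeroʳ (sgn j * + (r C j))) ⟩
      + (n C r) * + 0
        ≡⟨ ℤ.*-zeroʳ (+ (n C r)) ⟩
      + 0 ∎

  sumUpTo-no-internal : ∀ n →
    sumUpTo n k (n ∸ 0) (λ j → sgn j * binomZ (+ n) (+ 0 - + 1) * binomZ (+ 0 - + 1) (+ j)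
                                 * binomZ (+ n - + (j ℕ.* k)) (+ 0)) ≡ + 0
  sumUpTo-no-internal n = begin
    sumUpTo n k n _          ≡⟨ sumUpTo≡∑ n n _ (λ _ → + 0) (λ j _ → zero-factor (sgn j) _ _) (λ _ _ → refl) ⟩
    ∑ (suc n) (λ _ → + 0)    ≡⟨ ∑-≡0 (suc n) (λ _ → refl) ⟩
    + 0                      ∎
    where
    zero-factor : ∀ a b c → a * + 0 * b * c ≡ + 0
    zero-factor = solve-∀

module Forests (k : ℕ) where

  open import Data.Nat using (zero; _+_; _<_; _⊓_; z≤n; s≤s)
  import Data.Nat.Properties as ℕ
  open import Data.List using (List; []; _∷_; length; _++_; take; drop)
  import Data.List.Properties as List
  open import Data.List.Relation.Unary.All using (All; []; _∷_)
  import Data.List.Relation.Unary.All.Properties as All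
  open import Data.Fin using (Fin; toℕ; fromℕ<) renaming (zero to fzero; suc to fsuc)
  import Data.Fin.Properties as Fin
  open import Data.Product.Function.Dependent.Propositional using (Σ-↔)
  open import Data.Sum using (_⊎_; inj₁; inj₂)
  open import Data.Sum.Function.Propositional using (_⊎-↔_)
  open import Data.Empty using (⊥-elim)
  open import Function.Bundles using (_↔_; mk↔ₛ′)
  open import Function.Properties.Inverse using (↔-refl; ↔-trans)
  open import Function.Related.Propositional using (module EquationalReasoning)
  open import Relation.Nullary using (¬_)
  open import Relation.Binary.PropositionalEquality
  open Sum using (∑ℕ)
  open ForestCount k using (forests)

  mutual
    MaxDeg-irrelevant : ∀ {t} (p q : MaxDeg k t) → p ≡ q
    MaxDeg-irrelevant (node d ps) (node d′ qs) = cong₂ node (ℕ.≤-irrelevant d d′) (All-MaxDeg-irrelevant ps qs)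

    All-MaxDeg-irrelevant : ∀ {ts} (ps qs : All (MaxDeg k) ts) → ps ≡ qs
    All-MaxDeg-irrelevant [] [] = refl
    All-MaxDeg-irrelevant (p ∷ ps) (q ∷ qs) = cong₂ _∷_ (MaxDeg-irrelevant p q) (All-MaxDeg-irrelevant ps qs)

  mutual
    DegLt-irrelevant : ∀ {t} (p q : DegLt (suc k) t) → p ≡ q
    DegLt-irrelevant (node d ps) (node d′ qs) = cong₂ node (ℕ.≤-irrelevant d d′) (All-DegLt-irrelevant ps qs)

    All-DegLt-irrelevant : ∀ {ts} (ps qs : All (DegLt (suc k)) ts) → ps ≡ qs
    All-DegLt-irrelevant [] [] = refl
    All-DegLt-irrelevant (p ∷ ps) (q ∷ qs) = cong₂ _∷_ (DegLt-irrelevant p q) (All-DegLt-irrelevant ps qs)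

  mutual
    MaxDeg⇒DegLt : ∀ {t} → MaxDeg k t → DegLt (suc k) t
    MaxDeg⇒DegLt (node d ps) = node (s≤s d) (All-MaxDeg⇒DegLt ps)

    All-MaxDeg⇒DegLt : ∀ {ts} → All (MaxDeg k) ts → All (DegLt (suc k)) ts
    All-MaxDeg⇒DegLt [] = []
    All-MaxDeg⇒DegLt (p ∷ ps) = MaxDeg⇒DegLt p ∷ All-MaxDeg⇒DegLt ps

  mutual
    DegLt⇒MaxDeg : ∀ {t} → DegLt (suc k) t → MaxDeg k t
    DegLt⇒MaxDeg (node (s≤s d) ps) = node d (All-DegLt⇒MaxDeg ps)

    All-DegLt⇒MaxDeg : ∀ {ts} → All (DegLt (suc k)) ts → All (MaxDeg k) ts
    All-DegLt⇒MaxDeg [] = []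
    All-DegLt⇒MaxDeg (p ∷ ps) = DegLt⇒MaxDeg p ∷ All-DegLt⇒MaxDeg ps

  sizes-++ : ∀ ts us → sizes (ts ++ us) ≡ sizes ts + sizes us
  sizes-++ [] us = refl
  sizes-++ (t ∷ ts) us = trans (cong (λ x → size t + x) (sizes-++ ts us)) (sym (ℕ.+-assoc (size t) _ _))

  internals-++ : ∀ ts us → internals (ts ++ us) ≡ internals ts + internals us
  internals-++ [] us = refl
  internals-++ (t ∷ ts) us = trans (cong (λ x → internal t + x) (internals-++ ts us)) (sym (ℕ.+-assoc (internal t) _ _))

  length≤sizes : ∀ ts → length ts ≤ sizes ts
  length≤sizes [] = z≤n
  length≤sizes (node _ ∷ ts) = s≤s (ℕ.≤-trans (length≤sizes ts) (ℕ.m≤n+m _ _))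

  take-length-++ : ∀ {A : Set} (xs ys : List A) → take (length xs) (xs ++ ys) ≡ xs
  take-length-++ [] ys = refl
  take-length-++ (x ∷ xs) ys = cong (x ∷_) (take-length-++ xs ys)

  drop-length-++ : ∀ {A : Set} (xs ys : List A) → drop (length xs) (xs ++ ys) ≡ ys
  drop-length-++ [] ys = refl
  drop-length-++ (x ∷ xs) ys = drop-length-++ xs ys

  Fin0↔ : ∀ {A : Set} → ¬ A → Fin 0 ↔ A
  Fin0↔ ¬a = mk↔ₛ′ (λ ()) (λ a → ⊥-elim (¬a a)) (λ a → ⊥-elim (¬a a)) (λ ())

  Fin1↔ : ∀ {A : Set} (a₀ : A) → (∀ a → a ≡ a₀) → Fin 1 ↔ A
  Fin1↔ a₀ unique = mk↔ₛ′ (λ _ → a₀) (λ _ → fzero) (λ a → sym (unique a)) (λ { fzero → refl ; (fsuc ()) })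

  Σ-Fin-suc↔ : ∀ {N} (P : Fin (suc N) → Set) → (P fzero ⊎ Σ (Fin N) (λ i → P (fsuc i))) ↔ Σ (Fin (suc N)) P
  Σ-Fin-suc↔ P = mk↔ₛ′ to from (λ { (fzero , p) → refl ; (fsuc i , p) → refl })
                               (λ { (inj₁ p) → refl ; (inj₂ (i , p)) → refl })
    where
    to : _ → Σ (Fin _) P
    to (inj₁ p) = fzero , p
    to (inj₂ (i , p)) = fsuc i , p
    from : Σ (Fin _) P → _
    from (fzero , p) = inj₁ p
    from (fsuc i , p) = inj₂ (i , p)

  Fin-∑ℕ↔ : ∀ N (f : ℕ → ℕ) → Fin (∑ℕ N f) ↔ Σ (Fin N) (λ i → Fin (f (toℕ i)))
  Fin-∑ℕ↔ zero f = Fin0↔ (λ { (() , _) })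
  Fin-∑ℕ↔ (suc N) f = begin
    Fin (f 0 + ∑ℕ N (λ i → f (suc i)))                         ↔⟨ Fin.+↔⊎ ⟩
    (Fin (f 0) ⊎ Fin (∑ℕ N (λ i → f (suc i))))                 ↔⟨ ↔-refl ⊎-↔ Fin-∑ℕ↔ N (λ i → f (suc i)) ⟩
    (Fin (f 0) ⊎ Σ (Fin N) (λ i → Fin (f (suc (toℕ i)))))      ↔⟨ Σ-Fin-suc↔ (λ i → Fin (f (toℕ i))) ⟩
    Σ (Fin (suc N)) (λ i → Fin (f (toℕ i)))                    ∎
    where open EquationalReasoning

  IsForest : ℕ → ℕ → ℕ → List PTree → Set
  IsForest m n r ts = (length ts ≡ m) × (sizes ts ≡ n) × (internals ts ≡ r) × All (MaxDeg k) ts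

  Forest : ℕ → ℕ → ℕ → Set
  Forest m n r = Σ (List PTree) (IsForest m n r)

  IsForest-irrelevant : ∀ {m n r ts} (p q : IsForest m n r ts) → p ≡ q
  IsForest-irrelevant (l , s , i , ps) (l′ , s′ , i′ , qs) =
    cong₂ _,_ (ℕ.≡-irrelevant l l′)
      (cong₂ _,_ (ℕ.≡-irrelevant s s′) (cong₂ _,_ (ℕ.≡-irrelevant i i′) (All-MaxDeg-irrelevant ps qs)))

  Forest-≡ : ∀ {m n r ts us} {p : IsForest m n r ts} {q : IsForest m n r us} →
             ts ≡ us → _≡_ {A = Forest m n r} (ts , p) (us , q)
  Forest-≡ {p = p} {q} refl = cong (_ ,_) (IsForest-irrelevant p q)

  Fin↔Forest-0-0-0 : Fin 1 ↔ Forest 0 0 0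
  Fin↔Forest-0-0-0 = Fin1↔ ([] , refl , refl , refl , []) λ { ([] , _) → Forest-≡ refl }

  ¬Forest-0-0-suc : ∀ r → ¬ Forest 0 0 (suc r)
  ¬Forest-0-0-suc r ([] , _ , _ , () , _)

  ¬Forest-suc-0 : ∀ m r → ¬ Forest (suc m) 0 r
  ¬Forest-suc-0 m r (node _ ∷ _ , _ , () , _)

  ¬Forest-0-suc : ∀ n r → ¬ Forest 0 (suc n) r
  ¬Forest-0-suc n r ([] , _ , () , _)

  leaf∷↔ : ∀ {m n} → Forest m n 0 ↔ Forest (suc m) (suc n) 0
  leaf∷↔ {m} {n} = mk↔ₛ′ leaf∷ drop-leaf
    (λ { (node [] ∷ ts , _ , _ , _ , _ ∷ _) → Forest-≡ refl })
    (λ _ → Forest-≡ refl)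
    where
    leaf∷ : Forest m n 0 → Forest (suc m) (suc n) 0
    leaf∷ (ts , l , s , i , ps) = node [] ∷ ts , cong suc l , cong suc s , i , node z≤n [] ∷ ps
    drop-leaf : Forest (suc m) (suc n) 0 → Forest m n 0
    drop-leaf (node [] ∷ ts , l , s , i , _ ∷ ps) = ts , ℕ.suc-injective l , ℕ.suc-injective s , i , ps

  -- Deleting the root of the first tree, of degree i + 1, makes its children the first i + 1 trees.
  first-tree↔ : ∀ {m n r} →
    (Forest m n (suc r) ⊎ Σ (Fin k) (λ i → Forest (suc (toℕ i) + m) n r)) ↔ Forest (suc m) (suc n) (suc r)
  first-tree↔ {m} {n} {r} = mk↔ₛ′ plant uproot plant∘uproot uproot∘plant
    where
    Rooted = Σ (Fin k) (λ i → Forest (suc (toℕ i) + m) n r)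

    uproot : Forest (suc m) (suc n) (suc r) → Forest m n (suc r) ⊎ Rooted
    uproot (node [] ∷ ts , l , s , i , _ ∷ ps) = inj₁ (ts , ℕ.suc-injective l , ℕ.suc-injective s , i , ps)
    uproot (node cs@(_ ∷ _) ∷ ts , l , s , i , node d qs ∷ ps) =
      inj₂ (fromℕ< d , cs ++ ts , len , siz , int , All.++⁺ qs ps)
      where
      len : length (cs ++ ts) ≡ suc (toℕ (fromℕ< d)) + m
      len = trans (List.length-++ cs) (cong₂ _+_ (cong suc (sym (Fin.toℕ-fromℕ< d))) (ℕ.suc-injective l))
      siz : sizes (cs ++ ts) ≡ n
      siz = trans (sizes-++ cs ts) (ℕ.suc-injective s)
      int : internals (cs ++ ts) ≡ r
      int = trans (internals-++ cs ts) (ℕ.suc-injective i)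

    plant : Forest m n (suc r) ⊎ Rooted → Forest (suc m) (suc n) (suc r)
    plant (inj₁ (ts , l , s , i , ps)) = node [] ∷ ts , cong suc l , cong suc s , i , node z≤n [] ∷ ps
    plant (inj₂ (j , t ∷ ts , l , s , i , p ∷ ps)) =
      node cs ∷ drop (toℕ j) ts , len , siz , int , node degree≤k (p ∷ All.take⁺ (toℕ j) ps) ∷ All.drop⁺ (toℕ j) ps
      where
      cs = t ∷ take (toℕ j) ts
      length-ts : length ts ≡ toℕ j + m
      length-ts = ℕ.suc-injective l
      degree≤k : length cs ≤ k
      degree≤k = ℕ.≤-trans (s≤s (subst (_≤ toℕ j) (sym (List.length-take (toℕ j) ts)) (ℕ.m⊓n≤m (toℕ j) (length ts))))
                      (Fin.toℕ<n j)
      len : suc (length (drop (toℕ j) ts)) ≡ suc m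
      len = cong suc (trans (List.length-drop (toℕ j) ts) (trans (cong (_∸ toℕ j) length-ts) (ℕ.m+n∸m≡n (toℕ j) m)))
      siz : suc (sizes cs) + sizes (drop (toℕ j) ts) ≡ suc n
      siz = cong suc (trans (sym (sizes-++ cs (drop (toℕ j) ts)))
                            (trans (cong (λ us → sizes (t ∷ us)) (List.take++drop≡id (toℕ j) ts)) s))
      int : suc (internals cs) + internals (drop (toℕ j) ts) ≡ suc r
      int = cong suc (trans (sym (internals-++ cs (drop (toℕ j) ts)))
                            (trans (cong (λ us → internals (t ∷ us)) (List.take++drop≡id (toℕ j) ts)) i))

    plant∘uproot : ∀ f → plant (uproot f) ≡ f
    plant∘uproot (node [] ∷ ts , _ , _ , _ , _ ∷ _) = Forest-≡ refl
    plant∘uproot (node (c ∷ cs) ∷ ts , _ , _ , _ , node d (_ ∷ _) ∷ _) = Forest-≡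
      (trans (cong (λ j → node (c ∷ take j (cs ++ ts)) ∷ drop j (cs ++ ts)) (Fin.toℕ-fromℕ< d))
             (cong₂ (λ us vs → node (c ∷ us) ∷ vs) (take-length-++ cs ts) (drop-length-++ cs ts)))

    uproot∘plant : ∀ x → uproot (plant x) ≡ x
    uproot∘plant (inj₁ _) = cong inj₁ (Forest-≡ refl)
    uproot∘plant (inj₂ (j , t ∷ ts , l , _ , _ , _ ∷ _)) =
      cong inj₂ (Σ-≡ (Fin.toℕ-injective (begin
        toℕ (fromℕ< _)                   ≡⟨ Fin.toℕ-fromℕ< _ ⟩
        length (take (toℕ j) ts)         ≡⟨ List.length-take (toℕ j) ts ⟩
        toℕ j ⊓ length ts                ≡⟨ cong (toℕ j ⊓_) (ℕ.suc-injective l) ⟩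
        toℕ j ⊓ (toℕ j + m)              ≡⟨ ℕ.m≤n⇒m⊓n≡m (ℕ.m≤m+n (toℕ j) m) ⟩
        toℕ j                            ∎))
        (cong (t ∷_) (List.take++drop≡id (toℕ j) ts)))
      where
      open ≡-Reasoning
      Σ-≡ : ∀ {j j′ : Fin k} {us us′} {p q} → j ≡ j′ → us ≡ us′ →
            _≡_ {A = Rooted} (j , us , p) (j′ , us′ , q)
      Σ-≡ {j} refl eq = cong (λ f → _,_ {B = λ i → Forest (suc (toℕ i) + m) n r} j f) (Forest-≡ eq)

  Fin-forests↔ : ∀ n m r → Fin (forests m n r) ↔ Forest m n r
  Fin-forests↔ zero zero zero = Fin↔Forest-0-0-0
  Fin-forests↔ zero zero (suc r) = Fin0↔ (¬Forest-0-0-suc r)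
  Fin-forests↔ zero (suc m) r = Fin0↔ (¬Forest-suc-0 m r)
  Fin-forests↔ (suc n) zero r = Fin0↔ (¬Forest-0-suc n r)
  Fin-forests↔ (suc n) (suc m) zero = ↔-trans (Fin-forests↔ n m zero) leaf∷↔
  Fin-forests↔ (suc n) (suc m) (suc r) = begin
    Fin (forests m n (suc r) + ∑ℕ k (λ i → forests (suc i + m) n r))
      ↔⟨ Fin.+↔⊎ ⟩
    (Fin (forests m n (suc r)) ⊎ Fin (∑ℕ k (λ i → forests (suc i + m) n r)))
      ↔⟨ Fin-forests↔ n m (suc r) ⊎-↔ Fin-∑ℕ↔ k (λ i → forests (suc i + m) n r) ⟩
    (Forest m n (suc r) ⊎ Σ (Fin k) (λ i → Fin (forests (suc (toℕ i) + m) n r)))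
      ↔⟨ ↔-refl ⊎-↔ Σ-↔ ↔-refl (Fin-forests↔ n _ r) ⟩
    (Forest m n (suc r) ⊎ Σ (Fin k) (λ i → Forest (suc (toℕ i) + m) n r))
      ↔⟨ first-tree↔ ⟩
    Forest (suc m) (suc n) (suc r) ∎
    where open EquationalReasoning

  Forest-1↔MSet : ∀ n r → Forest 1 (suc n) r ↔ MSet k n r
  Forest-1↔MSet n r = mk↔ₛ′ tree singleton
    (λ { (t , _) → cong (t ,_)
           (cong₂ _,_ (ℕ.≡-irrelevant _ _) (cong₂ _,_ (ℕ.≡-irrelevant _ _) (MaxDeg-irrelevant _ _))) })
    (λ { (_ ∷ [] , _ , _ , _ , _ ∷ []) → Forest-≡ refl })
    where
    tree : Forest 1 (suc n) r → MSet k n r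
    tree (t ∷ [] , _ , s , i , p ∷ []) =
      t , trans (sym (ℕ.+-identityʳ (size t))) s , trans (sym (ℕ.+-identityʳ (internal t))) i , p
    singleton : MSet k n r → Forest 1 (suc n) r
    singleton (t , s , i , p) =
      t ∷ [] , refl , trans (ℕ.+-identityʳ (size t)) s , trans (ℕ.+-identityʳ (internal t)) i , p ∷ []

  ¬CSet-no-internal : ∀ n → ¬ CSet (suc k) (suc n) 0
  ¬CSet-no-internal n (node [] , () , _)

  -- A tree counted by C is a root above a forest of m trees, where m ≤ n + 1 since every tree has a node.
  Σ-Forest↔CSet : ∀ n r → Σ (Fin (suc (suc n))) (λ m → Forest (toℕ m) (suc n) r) ↔ CSet (suc k) (suc n) (suc r)
  Σ-Forest↔CSet n r = mk↔ₛ′ graft split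
    (λ { (node (_ ∷ _) , _) → cong (_ ,_)
           (cong₂ _,_ (ℕ.≡-irrelevant _ _) (cong₂ _,_ (ℕ.≡-irrelevant _ _) (All-DegLt-irrelevant _ _))) })
    (λ { (m , t ∷ ts , l , s , _) → Σ-≡ (Fin.toℕ-injective (trans (Fin.toℕ-fromℕ< (children≤ (t ∷ ts) s)) l)) })
    where
    Forests = λ (m : Fin (suc (suc n))) → Forest (toℕ m) (suc n) r
    children≤ : ∀ ts → sizes ts ≡ suc n → length ts < suc (suc n)
    children≤ ts s = s≤s (subst (length ts ≤_) s (length≤sizes ts))
    graft : Σ (Fin (suc (suc n))) Forests → CSet (suc k) (suc n) (suc r)
    graft (m , t ∷ ts , l , s , i , ps) = node (t ∷ ts) , cong suc s , cong suc i , All-MaxDeg⇒DegLt ps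
    split : CSet (suc k) (suc n) (suc r) → Σ (Fin (suc (suc n))) Forests
    split (node ts@(_ ∷ _) , s , i , ps) =
      fromℕ< m<n+2 , ts , sym (Fin.toℕ-fromℕ< m<n+2) , ℕ.suc-injective s , ℕ.suc-injective i , All-DegLt⇒MaxDeg ps
      where
      m<n+2 = children≤ ts (ℕ.suc-injective s)
    Σ-≡ : ∀ {m m′ : Fin (suc (suc n))} {ts p q} → m ≡ m′ →
          _≡_ {A = Σ (Fin (suc (suc n))) Forests} (m , ts , p) (m′ , ts , q)
    Σ-≡ {m} refl = cong (λ f → _,_ {B = Forests} m f) (Forest-≡ refl)

  Fin↔MSet : ∀ n r → Fin (forests 1 (suc n) r) ↔ MSet k n r
  Fin↔MSet n r = ↔-trans (Fin-forests↔ (suc n) 1 r) (Forest-1↔MSet n r)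

  Fin↔CSet : ∀ n r → Fin (∑ℕ (suc (suc n)) (λ m → forests m (suc n) r)) ↔ CSet (suc k) (suc n) (suc r)
  Fin↔CSet n r = begin
    Fin (∑ℕ (suc (suc n)) (λ m → forests m (suc n) r))                ↔⟨ Fin-∑ℕ↔ (suc (suc n)) (λ m → forests m (suc n) r) ⟩
    Σ (Fin (suc (suc n))) (λ m → Fin (forests (toℕ m) (suc n) r))     ↔⟨ Σ-↔ ↔-refl (Fin-forests↔ (suc n) _ r) ⟩
    Σ (Fin (suc (suc n))) (λ m → Forest (toℕ m) (suc n) r)            ↔⟨ Σ-Forest↔CSet n r ⟩
    CSet (suc k) (suc n) (suc r)                                     ∎
    where open EquationalReasoning

module _ (k : ℕ) where

  open import Data.Nat.Combinatorics using (_C_)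
  import Data.Integer.Properties as ℤ
  open import Data.Integer.Tactic.RingSolver using (solve-∀)
  open import Relation.Binary.PropositionalEquality
  open ≡-Reasoning
  open Sum
  open Compositions k
  open ForestCount k
  open Sieve k
  open Formulas k
  open Forests k

  -- Neither formula needs the hypothesis 1 ≤ k.
  M-formula : (n r : ℕ) → 1 ≤ k → r ≤ n →
    Σ ℕ (λ M → HasCard (MSet k n r) M ×
      (+ (suc n) ℤ.* + M ≡
        binomZ (+ (suc n)) (+ r) ℤ.*
          sumUpTo n k (n ∸ r) (λ j →
            sgn j ℤ.* binomZ (+ r) (+ j)
              ℤ.* binomZ (+ n ℤ.- + (j ℕ.* k) ℤ.- + 1) (+ r ℤ.- + 1))))
  M-formula n r _ r≤n =
    forests 1 (suc n) r , Fin↔MSet n r , (begin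
      + suc n ℤ.* + forests 1 (suc n) r
        ≡⟨ forests-formula (suc n) 1 r ⟩
      + 1 ℤ.* X ℤ.* compositions r (+ n)
        ≡⟨ cong (ℤ._* compositions r (+ n)) (ℤ.*-identityˡ X) ⟩
      X ℤ.* compositions r (+ n)
        ≡⟨ cong (X ℤ.*_) (compositions≡sieve r (+ n)) ⟩
      X ℤ.* sieve r (unboundedCompositions r) (+ n)
        ≡⟨ cong (X ℤ.*_) (sumUpTo≡compositions-sieve n r r≤n) ⟨
      binomZ (+ suc n) (+ r) ℤ.* sumUpTo n k (n ∸ r) _ ∎)
    where
    X = + (suc n C r)

  C-formula : (n r : ℕ) → 1 ≤ k → 1 ≤ n → r ≤ n →
    Σ ℕ (λ C → HasCard (CSet (suc k) n r) C ×
      (+ n ℤ.* + C ≡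
        sumUpTo n k (n ∸ r) (λ j →
          sgn j ℤ.* binomZ (+ n) (+ r ℤ.- + 1)
            ℤ.* binomZ (+ r ℤ.- + 1) (+ j)
            ℤ.* binomZ (+ n ℤ.- + (j ℕ.* k)) (+ r))))
  C-formula (suc n) 0 _ _ _ =
    0 , Fin0↔ (¬CSet-no-internal n) , trans (ℤ.*-zeroʳ (+ suc n)) (sym (sumUpTo-no-internal (suc n)))
  C-formula (suc n) (suc r) _ _ r<n =
    ∑ℕ (suc N) (λ m → forests m N r) , Fin↔CSet n r , (begin
      + N ℤ.* + ∑ℕ (suc N) (λ m → forests m N r)
        ≡⟨ cong (+ N ℤ.*_) (pos-∑ℕ (suc N) _) ⟩
      + N ℤ.* ∑ (suc N) (λ m → + forests m N r)
        ≡⟨ *-distribˡ-∑ (suc N) (+ N) _ ⟩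
      ∑ (suc N) (λ m → + N ℤ.* + forests m N r)
        ≡⟨ ∑-cong (suc N) (λ m → trans (forests-formula N m r) (regroup (+ m) X _)) ⟩
      ∑ (suc N) (λ m → X ℤ.* (+ m ℤ.* compositions r (+ N ℤ.- + m)))
        ≡⟨ *-distribˡ-∑ (suc N) X _ ⟨
      X ℤ.* ∑ (suc N) (λ m → + m ℤ.* compositions r (+ N ℤ.- + m))
        ≡⟨ cong (X ℤ.*_) (∑-*-compositions r N) ⟩
      X ℤ.* sieve r (choose (suc r)) (+ N)
        ≡⟨ sumUpTo≡choose-sieve N r r<n ⟨
      sumUpTo N k (N ∸ suc r) _ ∎)
    where
    N = suc n
    X = + (N C r)
    regroup : ∀ a b c → a ℤ.* b ℤ.* c ≡ b ℤ.* (a ℤ.* c)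
    regroup = solve-∀

proposition6p4 : ((k n r : ℕ) → 1 ≤ k → r ≤ n →
    Σ ℕ (λ M → HasCard (MSet k n r) M ×
    (+ (suc n) ℤ.* + M ≡
    binomZ (+ (suc n)) (+ r) ℤ.*
    sumUpTo n k (n ∸ r) (λ j →
    sgn j ℤ.* binomZ (+ r) (+ j)
    ℤ.* binomZ (+ n ℤ.- + (j ℕ.* k) ℤ.- + 1) (+ r ℤ.- + 1)))))
    ×
    ((k n r : ℕ) → 1 ≤ k → 1 ≤ n → r ≤ n →
    Σ ℕ (λ C → HasCard (CSet (suc k) n r) C ×
    (+ n ℤ.* + C ≡
    sumUpTo n k (n ∸ r) (λ j →
    sgn j ℤ.* binomZ (+ n) (+ r ℤ.- + 1)
    ℤ.* binomZ (+ r ℤ.- + 1) (+ j)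
    ℤ.* binomZ (+ n ℤ.- + (j ℕ.* k)) (+ r)))))
proposition6p4 = M-formula , C-formula
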